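{- Let $C : \mathsf{Form} \to \mathsf{Prop}$ be any predicate, $\mathsf{Code}$ any type and $\mathsf{eval} : \mathsf{Code} \to \mathsf{Code} \to \mathsf{Form}$ any function. Assume: (i) for every function $f : \mathsf{Code} \to \mathsf{Form}$ there exists $c \in \mathsf{Code}$ such that for all $x \in \mathsf{Code}$, $\mathsf{eval}(c,x) \simeq_C f(x)$; (ii) for all formulas $A,B$, if $C(A \to B)$ and $C(A)$ then $C(B)$; (iii) there exists a function $d : \mathsf{Form} \to \{\mathsf{tt},\mathsf{ff}\}$ such that for every formula $A$, $d(A) = \mathsf{tt}$ implies $C(A)$ and $d(A) = \mathsf{ff}$ implies $C(\neg A)$. Then there exists a formula $B$ such that $B \simeq_C \neg B$, and $C(B) \lor C(\neg B)$, and $C(\bot)$.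
   Context: $\mathsf{Form}$ is the type of closed formulas generated by $A,B ::= \bot \mid A \to B$; $\neg A$ abbreviates $A \to \bot$. For a predicate $C$ on $\mathsf{Form}$, $A \simeq_C B$ means $C(A \to B) \land C(B \to A)$. -}

module Defs where

open import Data.Product using (_×_)

data Form : Set where
  ⊥f  : Form
  _⇒_ : Form → Form → Form

infixr 5 _⇒_

¬f_ : Form → Form
¬f A = A ⇒ ⊥f

_≃[_]_ : Form → (Form → Set) → Form → Set
A ≃[ C ] B = C (A ⇒ B) × C (B ⇒ A)

{-# OPTIONS --safe #-}
module Submission where

open import Defs
open import Data.Bool using (Bool; true; false)
open import Data.Product using (Σ; _×_; _,_; proj₁; proj₂)
open import Data.Sum using (_⊎_; inj₁; inj₂)
open import Relation.Binary.PropositionalEquality using (_≡_)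

module _ {C : Form → Set} where

  -- Lawvere's diagonal argument: the fixed point is eval c c, where c represents x ↦ g (eval x x).
  diagonal-fixpoint : {Code : Set} (eval : Code → Code → Form) →
    ((f : Code → Form) → Σ Code (λ c → (x : Code) → eval c x ≃[ C ] f x)) →
    (g : Form → Form) → Σ Form (λ B → B ≃[ C ] g B)
  diagonal-fixpoint {Code} eval represent g = eval c c , eval-c≃ c
    where
    diagonal : Σ Code (λ c → (x : Code) → eval c x ≃[ C ] g (eval x x))
    diagonal = represent (λ x → g (eval x x))
    c : Code
    c = proj₁ diagonal
    eval-c≃ : (x : Code) → eval c x ≃[ C ] g (eval x x)
    eval-c≃ = proj₂ diagonal

  decider⇒complete :
    Σ (Form → Bool) (λ d → (A : Form) → (d A ≡ true → C A) × (d A ≡ false → C (¬f A))) →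
    (A : Form) → C A ⊎ C (¬f A)
  decider⇒complete (d , sound) A with d A in eq
  ... | true  = inj₁ (proj₁ (sound A) eq)
  ... | false = inj₂ (proj₂ (sound A) eq)

  liar⇒⊥ : ((A B : Form) → C (A ⇒ B) → C A → C B) →
    {B : Form} → B ≃[ C ] (¬f B) → C B ⊎ C (¬f B) → C ⊥f
  liar⇒⊥ mp {B} (B⇒¬B , ¬B⇒B) (inj₁ cB)  = mp B ⊥f (mp B (¬f B) B⇒¬B cB) cB
  liar⇒⊥ mp {B} (B⇒¬B , ¬B⇒B) (inj₂ c¬B) = mp B ⊥f c¬B (mp (¬f B) B ¬B⇒B c¬B)

lemma3p11 : (C : Form → Set) (Code : Set) (eval : Code → Code → Form) →
    ((f : Code → Form) → Σ Code (λ c → (x : Code) → eval c x ≃[ C ] f x)) →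
    ((A B : Form) → C (A ⇒ B) → C A → C B) →
    Σ (Form → Bool) (λ d → (A : Form) → (d A ≡ true → C A) × (d A ≡ false → C (¬f A))) →
    Σ Form (λ B → (B ≃[ C ] (¬f B)) × ((C B ⊎ C (¬f B)) × C ⊥f))
lemma3p11 C Code eval represent mp decider = B , B≃¬B , settled , liar⇒⊥ mp B≃¬B settled
  where
  liar : Σ Form (λ B → B ≃[ C ] (¬f B))
  liar = diagonal-fixpoint {C} eval represent ¬f_
  B : Form
  B = proj₁ liar
  B≃¬B : B ≃[ C ] (¬f B)
  B≃¬B = proj₂ liar
  settled : C B ⊎ C (¬f B)
  settled = decider⇒complete decider B
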